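{- Let $\mathcal{H}$ be a pre-Hilbert category and $X$ an object. Then there is an order isomorphism $\mathrm{ClSub}(X)\cong\mathrm{Proj}(X)$, sending a subobject represented by a $\dagger$-mono $m$ to the projection $mm^\dagger$.
   Context: A $\dagger$-category is a category $\mathcal{H}$ with a functor $\dagger:\mathcal{H}^{\mathrm{op}}\to\mathcal{H}$ that is the identity on objects with $f^{\dagger\dagger}=f$. A morphism $m$ is a $\dagger$-mono if $m^\dagger m=\mathrm{id}$, a $\dagger$-epi if $mm^\dagger=\mathrm{id}$, a $\dagger$-iso if both. A pre-Hilbert category is a $\dagger$-category such that: it has finite $\dagger$-biproducts (finite biproducts, including a zero object, with $\pi^\dagger=\kappa$); it has finite $\dagger$-equalisers (equalisers that are $\dagger$-monos); every $\dagger$-mono is a kernel of some morphism; and it is symmetric $\dagger$-monoidal ($(f\otimes g)^\dagger=f^\dagger\otimes g^\dagger$, coherence isomorphisms $\dagger$-isos). A subobject of $X$ is an equivalence class of monos into $X$ (modulo isomorphism of domains commuting with the monos), ordered by $M\le N$ iff $m=nf$ for some $f$; $\mathrm{ClSub}(X)$ is the poset of subobjects representable by a $\dagger$-mono. A projection on $X$ is a morphism $p:X\to X$ with $p\circ p=p=p^\dagger$; $\mathrm{Proj}(X)$ is the set of projections on $X$ ordered by $p\sqsubseteq q$ iff $p\circ q=p$. -}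

module Defs where

open import Level using (Level; _⊔_) renaming (suc to lsuc)
open import Data.Product using (Σ; ∃; ∃-syntax; _×_; _,_)
open import Relation.Binary using (IsEquivalence)

record Category (o ℓ e : Level) : Set (lsuc (o ⊔ ℓ ⊔ e)) where
  infixr 9 _∘_
  infix  4 _≈_
  field
    Obj  : Set o
    _⇒_  : Obj → Obj → Set ℓ
    _≈_  : ∀ {A B} → A ⇒ B → A ⇒ B → Set e
    id   : ∀ {A} → A ⇒ A
    _∘_  : ∀ {A B C} → B ⇒ C → A ⇒ B → A ⇒ C
    ≈-equiv   : ∀ {A B} → IsEquivalence (_≈_ {A} {B})
    ∘-resp-≈  : ∀ {A B C} {f f' : B ⇒ C} {g g' : A ⇒ B} →
                f ≈ f' → g ≈ g' → f ∘ g ≈ f' ∘ g'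
    identityˡ : ∀ {A B} {f : A ⇒ B} → id ∘ f ≈ f
    identityʳ : ∀ {A B} {f : A ⇒ B} → f ∘ id ≈ f
    assoc     : ∀ {A B C D} {f : A ⇒ B} {g : B ⇒ C} {h : C ⇒ D} →
                (h ∘ g) ∘ f ≈ h ∘ (g ∘ f)

record DaggerCategory (o ℓ e : Level) : Set (lsuc (o ⊔ ℓ ⊔ e)) where
  field
    category : Category o ℓ e
  open Category category public
  infix 15 _†
  field
    _†            : ∀ {A B} → A ⇒ B → B ⇒ A
    †-resp-≈      : ∀ {A B} {f g : A ⇒ B} → f ≈ g → f † ≈ g †
    †-identity    : ∀ {A} → (id {A}) † ≈ id
    †-homomorphism : ∀ {A B C} {f : B ⇒ C} {g : A ⇒ B} →
                     (f ∘ g) † ≈ g † ∘ f †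
    †-involutive  : ∀ {A B} {f : A ⇒ B} → (f †) † ≈ f

  IsDaggerMono : ∀ {A B} → A ⇒ B → Set e
  IsDaggerMono m = m † ∘ m ≈ id

  IsDaggerEpi : ∀ {A B} → A ⇒ B → Set e
  IsDaggerEpi m = m ∘ m † ≈ id

  IsDaggerIso : ∀ {A B} → A ⇒ B → Set e
  IsDaggerIso m = IsDaggerMono m × IsDaggerEpi m

  IsIso : ∀ {A B} → A ⇒ B → Set (ℓ ⊔ e)
  IsIso {A} {B} f = Σ (B ⇒ A) λ g → (g ∘ f ≈ id) × (f ∘ g ≈ id)

  record IsEqualiser {E A B : Obj} (eq : E ⇒ A) (f g : A ⇒ B)
         : Set (o ⊔ ℓ ⊔ e) where
    field
      equalise  : f ∘ eq ≈ g ∘ eq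
      factor    : ∀ {C} (h : C ⇒ A) → f ∘ h ≈ g ∘ h → C ⇒ E
      factor-eq : ∀ {C} (h : C ⇒ A) (p : f ∘ h ≈ g ∘ h) → eq ∘ factor h p ≈ h
      factor-unique : ∀ {C} (h : C ⇒ A) (u : C ⇒ E) → eq ∘ u ≈ h →
                      ∀ (p : f ∘ h ≈ g ∘ h) → u ≈ factor h p

  record IsZeroObject (Z : Obj) : Set (o ⊔ ℓ ⊔ e) where
    field
      ¡        : ∀ {A} → Z ⇒ A
      !        : ∀ {A} → A ⇒ Z
      ¡-unique : ∀ {A} (f : Z ⇒ A) → f ≈ ¡
      !-unique : ∀ {A} (f : A ⇒ Z) → f ≈ !

  record IsProduct {A B P : Obj} (π₁ : P ⇒ A) (π₂ : P ⇒ B) : Set (o ⊔ ℓ ⊔ e) where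
    field
      ⟨_,_⟩    : ∀ {C} → C ⇒ A → C ⇒ B → C ⇒ P
      project₁ : ∀ {C} {f : C ⇒ A} {g : C ⇒ B} → π₁ ∘ ⟨ f , g ⟩ ≈ f
      project₂ : ∀ {C} {f : C ⇒ A} {g : C ⇒ B} → π₂ ∘ ⟨ f , g ⟩ ≈ g
      unique   : ∀ {C} {f : C ⇒ A} {g : C ⇒ B} (h : C ⇒ P) →
                 π₁ ∘ h ≈ f → π₂ ∘ h ≈ g → h ≈ ⟨ f , g ⟩

  record IsCoproduct {A B P : Obj} (κ₁ : A ⇒ P) (κ₂ : B ⇒ P) : Set (o ⊔ ℓ ⊔ e) where
    field
      [_,_]    : ∀ {C} → A ⇒ C → B ⇒ C → P ⇒ C
      inject₁  : ∀ {C} {f : A ⇒ C} {g : B ⇒ C} → [ f , g ] ∘ κ₁ ≈ f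
      inject₂  : ∀ {C} {f : A ⇒ C} {g : B ⇒ C} → [ f , g ] ∘ κ₂ ≈ g
      unique   : ∀ {C} {f : A ⇒ C} {g : B ⇒ C} (h : P ⇒ C) →
                 h ∘ κ₁ ≈ f → h ∘ κ₂ ≈ g → h ≈ [ f , g ]

record PreHilbert (o ℓ e : Level) : Set (lsuc (o ⊔ ℓ ⊔ e)) where
  field
    dagger : DaggerCategory o ℓ e
  open DaggerCategory dagger public

  field
    𝟎      : Obj
    𝟎-zero : IsZeroObject 𝟎

  0⇒ : ∀ {A B} → A ⇒ B
  0⇒ = IsZeroObject.¡ 𝟎-zero ∘ IsZeroObject.! 𝟎-zero

  infixr 6 _⊕_
  field
    _⊕_ : Obj → Obj → Obj
    π₁  : ∀ {A B} → (A ⊕ B) ⇒ A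
    π₂  : ∀ {A B} → (A ⊕ B) ⇒ B
    κ₁  : ∀ {A B} → A ⇒ (A ⊕ B)
    κ₂  : ∀ {A B} → B ⇒ (A ⊕ B)
    ⊕-product   : ∀ {A B} → IsProduct (π₁ {A} {B}) π₂
    ⊕-coproduct : ∀ {A B} → IsCoproduct (κ₁ {A} {B}) κ₂
    π₁κ₁ : ∀ {A B} → π₁ ∘ κ₁ {A} {B} ≈ id
    π₂κ₂ : ∀ {A B} → π₂ ∘ κ₂ {A} {B} ≈ id
    π₁κ₂ : ∀ {A B} → π₁ ∘ κ₂ {A} {B} ≈ 0⇒
    π₂κ₁ : ∀ {A B} → π₂ ∘ κ₁ {A} {B} ≈ 0⇒
    π₁† : ∀ {A B} → (π₁ {A} {B}) † ≈ κ₁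
    π₂† : ∀ {A B} → (π₂ {A} {B}) † ≈ κ₂

  field
    Eq        : ∀ {A B} → A ⇒ B → A ⇒ B → Obj
    eq        : ∀ {A B} (f g : A ⇒ B) → Eq f g ⇒ A
    eq-equaliser : ∀ {A B} (f g : A ⇒ B) → IsEqualiser (eq f g) f g
    eq-†mono  : ∀ {A B} (f g : A ⇒ B) → IsDaggerMono (eq f g)

  field
    †mono-kernel : ∀ {K A} (m : K ⇒ A) → IsDaggerMono m →
                   Σ Obj λ B → Σ (A ⇒ B) λ f → IsEqualiser m f 0⇒

  infixr 10 _⊗₀_ _⊗₁_
  field
    _⊗₀_ : Obj → Obj → Obj
    _⊗₁_ : ∀ {A B C D} → A ⇒ B → C ⇒ D → (A ⊗₀ C) ⇒ (B ⊗₀ D)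
    ⊗-resp-≈ : ∀ {A B C D} {f f' : A ⇒ B} {g g' : C ⇒ D} →
               f ≈ f' → g ≈ g' → f ⊗₁ g ≈ f' ⊗₁ g'
    ⊗-identity : ∀ {A B} → id {A} ⊗₁ id {B} ≈ id
    ⊗-homomorphism : ∀ {A B C D E F} {f : A ⇒ B} {g : B ⇒ C}
                     {h : D ⇒ E} {k : E ⇒ F} →
                     (g ∘ f) ⊗₁ (k ∘ h) ≈ (g ⊗₁ k) ∘ (f ⊗₁ h)
    unit : Obj
    α    : ∀ {A B C} → ((A ⊗₀ B) ⊗₀ C) ⇒ (A ⊗₀ (B ⊗₀ C))
    λ⇒   : ∀ {A} → (unit ⊗₀ A) ⇒ A
    ρ⇒   : ∀ {A} → (A ⊗₀ unit) ⇒ A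
    σ    : ∀ {A B} → (A ⊗₀ B) ⇒ (B ⊗₀ A)
    α-natural : ∀ {A B C D E F} {f : A ⇒ D} {g : B ⇒ E} {h : C ⇒ F} →
                α ∘ ((f ⊗₁ g) ⊗₁ h) ≈ (f ⊗₁ (g ⊗₁ h)) ∘ α
    λ-natural : ∀ {A B} {f : A ⇒ B} → λ⇒ ∘ (id ⊗₁ f) ≈ f ∘ λ⇒
    ρ-natural : ∀ {A B} {f : A ⇒ B} → ρ⇒ ∘ (f ⊗₁ id) ≈ f ∘ ρ⇒
    σ-natural : ∀ {A B C D} {f : A ⇒ B} {g : C ⇒ D} →
                σ ∘ (f ⊗₁ g) ≈ (g ⊗₁ f) ∘ σ
    pentagon : ∀ {A B C D} →
               α {A} {B} {C ⊗₀ D} ∘ α {A ⊗₀ B} {C} {D}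
                 ≈ (id ⊗₁ α {B} {C} {D}) ∘ (α {A} {B ⊗₀ C} {D} ∘ (α {A} {B} {C} ⊗₁ id))
    triangle : ∀ {A B} → (id {A} ⊗₁ λ⇒ {B}) ∘ α ≈ ρ⇒ ⊗₁ id
    hexagon  : ∀ {A B C} →
               α {B} {C} {A} ∘ (σ {A} {B ⊗₀ C} ∘ α {A} {B} {C})
                 ≈ (id ⊗₁ σ {A} {C}) ∘ (α {B} {A} {C} ∘ (σ {A} {B} ⊗₁ id))
    symmetry : ∀ {A B} → σ {B} {A} ∘ σ {A} {B} ≈ id
    ⊗-† : ∀ {A B C D} {f : A ⇒ B} {g : C ⇒ D} → (f ⊗₁ g) † ≈ f † ⊗₁ g †
    α-†iso : ∀ {A B C} → IsDaggerIso (α {A} {B} {C})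
    λ-†iso : ∀ {A} → IsDaggerIso (λ⇒ {A})
    ρ-†iso : ∀ {A} → IsDaggerIso (ρ⇒ {A})
    σ-†iso : ∀ {A B} → IsDaggerIso (σ {A} {B})

  -- Closed subobjects, represented by †-monos

  record †Mono (X : Obj) : Set (o ⊔ ℓ ⊔ e) where
    constructor †mono
    field
      {dom} : Obj
      arr   : dom ⇒ X
      isDaggerMono : IsDaggerMono arr
  open †Mono public

  _≤ₛ_ : ∀ {X} → †Mono X → †Mono X → Set (ℓ ⊔ e)
  M ≤ₛ N = Σ (dom M ⇒ dom N) λ f → arr M ≈ arr N ∘ f

  _≅ₛ_ : ∀ {X} → †Mono X → †Mono X → Set (ℓ ⊔ e)
  M ≅ₛ N = Σ (dom M ⇒ dom N) λ f → IsIso f × (arr M ≈ arr N ∘ f)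

  IsProjection : ∀ {X} → X ⇒ X → Set e
  IsProjection p = (p ∘ p ≈ p) × (p † ≈ p)

  _⊑_ : ∀ {X} → X ⇒ X → X ⇒ X → Set e
  p ⊑ q = p ∘ q ≈ p

  toProj : ∀ {X} → †Mono X → X ⇒ X
  toProj M = arr M ∘ arr M †

-- A †-mono m splits as m† ∘ m = id, so m ∘ m† is a self-adjoint idempotent whose fixed maps are exactly those
-- factoring through m. Hence M ≤ N iff n n† ∘ m = m iff n n† ∘ m m† = m m† iff, taking daggers, m m† ⊑ n n†;
-- as ⊑ is antisymmetric on self-adjoint maps, M ↦ m m† is an order embedding of ClSub(X) into Proj(X).
-- It is onto because a projection p equals m m† for the †-equaliser m of p and id.
module Submission where

open import Defs
open import Level using (Level)
open import Data.Product using (Σ; _×_; _,_; proj₁; proj₂)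
open import Function.Bundles using (Equivalence; _⇔_; mk⇔)
import Function.Properties.Equivalence as ⇔
open import Relation.Binary.Bundles using (Setoid)
import Relation.Binary.Reasoning.Setoid as SetoidReasoning

module DaggerCategoryProperties {o ℓ e : Level} (D : DaggerCategory o ℓ e) where
  open DaggerCategory D

  hom-setoid : Obj → Obj → Setoid ℓ e
  hom-setoid A B = record { Carrier = A ⇒ B ; _≈_ = _≈_ ; isEquivalence = ≈-equiv }

  module _ {A B : Obj} where
    open Setoid (hom-setoid A B) public using (refl; sym; trans)

  module HomReasoning {A B : Obj} = SetoidReasoning (hom-setoid A B)
  open HomReasoning

  infixr 4 _⟩∘⟨_
  _⟩∘⟨_ : ∀ {A B C} {f f' : B ⇒ C} {g g' : A ⇒ B} → f ≈ f' → g ≈ g' → f ∘ g ≈ f' ∘ g'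
  _⟩∘⟨_ = ∘-resp-≈

  elimʳ : ∀ {A B} {f : A ⇒ B} {g : A ⇒ A} → g ≈ id → f ∘ g ≈ f
  elimʳ g≈id = trans (refl ⟩∘⟨ g≈id) identityʳ

  elimˡ : ∀ {A B} {f : B ⇒ B} {g : A ⇒ B} → f ≈ id → f ∘ g ≈ g
  elimˡ f≈id = trans (f≈id ⟩∘⟨ refl) identityˡ

  †-selfAdjoint-∘† : ∀ {A B} (m : A ⇒ B) → (m ∘ m †) † ≈ m ∘ m †
  †-selfAdjoint-∘† m = trans †-homomorphism (†-involutive ⟩∘⟨ refl)

  module _ {A B} {m : A ⇒ B} (m-†mono : IsDaggerMono m) where

    m∘m†∘m≈m : (m ∘ m †) ∘ m ≈ m
    m∘m†∘m≈m = trans assoc (elimʳ m-†mono)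

    ∘†-idempotent : (m ∘ m †) ∘ (m ∘ m †) ≈ m ∘ m †
    ∘†-idempotent = trans (sym assoc) (m∘m†∘m≈m ⟩∘⟨ refl)

    †mono-cancelˡ : ∀ {C} {f g : C ⇒ A} → m ∘ f ≈ m ∘ g → f ≈ g
    †mono-cancelˡ {f = f} {g} mf≈mg = begin
      f               ≈⟨ elimˡ m-†mono ⟨
      (m † ∘ m) ∘ f   ≈⟨ assoc ⟩
      m † ∘ (m ∘ f)   ≈⟨ refl ⟩∘⟨ mf≈mg ⟩
      m † ∘ (m ∘ g)   ≈⟨ assoc ⟨
      (m † ∘ m) ∘ g   ≈⟨ elimˡ m-†mono ⟩
      g               ∎

    fixes⇔fixes-∘† : (p : B ⇒ B) → (p ∘ m ≈ m) ⇔ (p ∘ (m ∘ m †) ≈ m ∘ m †)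
    fixes⇔fixes-∘† p = mk⇔ (λ pm≈m → trans (sym assoc) (pm≈m ⟩∘⟨ refl)) fixes-∘†⇒fixes
      where
      fixes-∘†⇒fixes : p ∘ (m ∘ m †) ≈ m ∘ m † → p ∘ m ≈ m
      fixes-∘†⇒fixes pmm†≈mm† = begin
        p ∘ m                 ≈⟨ refl ⟩∘⟨ m∘m†∘m≈m ⟨
        p ∘ ((m ∘ m †) ∘ m)   ≈⟨ assoc ⟨
        (p ∘ (m ∘ m †)) ∘ m   ≈⟨ pmm†≈mm† ⟩∘⟨ refl ⟩
        (m ∘ m †) ∘ m         ≈⟨ m∘m†∘m≈m ⟩
        m                     ∎

  mutual-factors⇒inverse : ∀ {A B C} {a : A ⇒ C} {b : B ⇒ C} {u : A ⇒ B} {v : B ⇒ A} →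
                           IsDaggerMono a → a ≈ b ∘ u → b ≈ a ∘ v → v ∘ u ≈ id
  mutual-factors⇒inverse {a = a} {b} {u} {v} a-†mono a≈bu b≈av = †mono-cancelˡ a-†mono (begin
    a ∘ (v ∘ u)   ≈⟨ assoc ⟨
    (a ∘ v) ∘ u   ≈⟨ sym b≈av ⟩∘⟨ refl ⟩
    b ∘ u         ≈⟨ a≈bu ⟨
    a             ≈⟨ identityʳ ⟨
    a ∘ id        ∎)

  factor⇒fixed-by-∘† : ∀ {A B C} {m : A ⇒ C} {n : B ⇒ C} {f : A ⇒ B} →
                       IsDaggerMono n → m ≈ n ∘ f → (n ∘ n †) ∘ m ≈ m
  factor⇒fixed-by-∘† {m = m} {n} {f} n-†mono m≈nf = begin
    (n ∘ n †) ∘ m         ≈⟨ refl ⟩∘⟨ m≈nf ⟩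
    (n ∘ n †) ∘ (n ∘ f)   ≈⟨ assoc ⟨
    ((n ∘ n †) ∘ n) ∘ f   ≈⟨ m∘m†∘m≈m n-†mono ⟩∘⟨ refl ⟩
    n ∘ f                 ≈⟨ m≈nf ⟨
    m                     ∎

  module _ {A} {p q r : A ⇒ A} (p-selfAdjoint : p † ≈ p) (q-selfAdjoint : q † ≈ q) where

    selfAdjoint-swap : r † ≈ r → p ∘ q ≈ r → q ∘ p ≈ r
    selfAdjoint-swap r-selfAdjoint pq≈r = begin
      q ∘ p         ≈⟨ q-selfAdjoint ⟩∘⟨ p-selfAdjoint ⟨
      q † ∘ p †     ≈⟨ †-homomorphism ⟨
      (p ∘ q) †     ≈⟨ †-resp-≈ pq≈r ⟩
      r †           ≈⟨ r-selfAdjoint ⟩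
      r             ∎

  selfAdjoint-absorb-antisym : ∀ {A} {p q : A ⇒ A} → p † ≈ p → q † ≈ q →
                               p ∘ q ≈ p → q ∘ p ≈ q → p ≈ q
  selfAdjoint-absorb-antisym p-selfAdjoint q-selfAdjoint pq≈p qp≈q =
    trans (sym (selfAdjoint-swap p-selfAdjoint q-selfAdjoint p-selfAdjoint pq≈p)) qp≈q

  †equaliser-of-projection : ∀ {A E} {p : A ⇒ A} {m : E ⇒ A} →
                             IsEqualiser m p id → IsDaggerMono m →
                             p ∘ p ≈ p → p † ≈ p → m ∘ m † ≈ p
  †equaliser-of-projection {A} {E} {p} {m} m-equaliser m-†mono pp≈p p†≈p = begin
    m ∘ m †   ≈⟨ refl ⟩∘⟨ k≈m† ⟨
    m ∘ k     ≈⟨ factor-eq p p-equalises ⟩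
    p         ∎
    where
    open IsEqualiser m-equaliser
    p-equalises : p ∘ p ≈ id ∘ p
    p-equalises = trans pp≈p (sym identityˡ)
    k : A ⇒ E
    k = factor p p-equalises
    k≈m† : k ≈ m †
    k≈m† = begin
      k               ≈⟨ elimˡ m-†mono ⟨
      (m † ∘ m) ∘ k   ≈⟨ assoc ⟩
      m † ∘ (m ∘ k)   ≈⟨ refl ⟩∘⟨ factor-eq p p-equalises ⟩
      m † ∘ p         ≈⟨ refl ⟩∘⟨ p†≈p ⟨
      m † ∘ p †       ≈⟨ †-homomorphism ⟨
      (p ∘ m) †       ≈⟨ †-resp-≈ (trans equalise identityˡ) ⟩
      m †             ∎

module ClosedSubobjectProperties {o ℓ e : Level} (H : PreHilbert o ℓ e) where
  open PreHilbert H
  open DaggerCategoryProperties dagger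
  open HomReasoning

  toProj-isProjection : ∀ {X} (M : †Mono X) → IsProjection (toProj M)
  toProj-isProjection (†mono m m-†mono) = ∘†-idempotent m-†mono , †-selfAdjoint-∘† m

  ≤ₛ⇔⊑ : ∀ {X} (M N : †Mono X) → (M ≤ₛ N) ⇔ (toProj M ⊑ toProj N)
  ≤ₛ⇔⊑ (†mono m m-†mono) (†mono n n-†mono) =
    ⇔.trans ≤ₛ⇔fixed (⇔.trans (fixes⇔fixes-∘† m-†mono (n ∘ n †)) swap)
    where
    ≤ₛ⇔fixed : (†mono m m-†mono ≤ₛ †mono n n-†mono) ⇔ ((n ∘ n †) ∘ m ≈ m)
    ≤ₛ⇔fixed = mk⇔ (λ (_ , m≈nf) → factor⇒fixed-by-∘† n-†mono m≈nf)
                   (λ nn†m≈m → n † ∘ m , trans (sym nn†m≈m) assoc)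
    swap : ((n ∘ n †) ∘ (m ∘ m †) ≈ m ∘ m †) ⇔ ((m ∘ m †) ∘ (n ∘ n †) ≈ m ∘ m †)
    swap = mk⇔ (selfAdjoint-swap (†-selfAdjoint-∘† n) (†-selfAdjoint-∘† m) (†-selfAdjoint-∘† m))
               (selfAdjoint-swap (†-selfAdjoint-∘† m) (†-selfAdjoint-∘† n) (†-selfAdjoint-∘† m))

  ≅ₛ⇒≤ₛ : ∀ {X} (M N : †Mono X) → M ≅ₛ N → M ≤ₛ N
  ≅ₛ⇒≤ₛ _ _ (f , _ , m≈nf) = f , m≈nf

  ≅ₛ⇒≥ₛ : ∀ {X} (M N : †Mono X) → M ≅ₛ N → N ≤ₛ M
  ≅ₛ⇒≥ₛ (†mono m _) (†mono n _) (f , (g , _ , fg≈id) , m≈nf) =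
    g , (begin
      n             ≈⟨ elimʳ fg≈id ⟨
      n ∘ (f ∘ g)   ≈⟨ assoc ⟨
      (n ∘ f) ∘ g   ≈⟨ sym m≈nf ⟩∘⟨ refl ⟩
      m ∘ g         ∎)

  ≤ₛ-antisym : ∀ {X} (M N : †Mono X) → M ≤ₛ N → N ≤ₛ M → M ≅ₛ N
  ≤ₛ-antisym (†mono m m-†mono) (†mono n n-†mono) (f , m≈nf) (g , n≈mg) =
    f , (g , mutual-factors⇒inverse m-†mono m≈nf n≈mg
           , mutual-factors⇒inverse n-†mono n≈mg m≈nf) , m≈nf

  ⊑-reflexive : ∀ {X} {p q : X ⇒ X} → p ∘ p ≈ p → p ≈ q → p ⊑ q
  ⊑-reflexive pp≈p p≈q = trans (refl ⟩∘⟨ sym p≈q) pp≈p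

  toProj-resp-≅ₛ : ∀ {X} (M N : †Mono X) → M ≅ₛ N → toProj M ≈ toProj N
  toProj-resp-≅ₛ M N M≅N =
    selfAdjoint-absorb-antisym (proj₂ (toProj-isProjection M)) (proj₂ (toProj-isProjection N))
      (Equivalence.to (≤ₛ⇔⊑ M N) (≅ₛ⇒≤ₛ M N M≅N))
      (Equivalence.to (≤ₛ⇔⊑ N M) (≅ₛ⇒≥ₛ M N M≅N))

  toProj-injective : ∀ {X} (M N : †Mono X) → toProj M ≈ toProj N → M ≅ₛ N
  toProj-injective M N pM≈pN = ≤ₛ-antisym M N
    (Equivalence.from (≤ₛ⇔⊑ M N) (⊑-reflexive (proj₁ (toProj-isProjection M)) pM≈pN))
    (Equivalence.from (≤ₛ⇔⊑ N M) (⊑-reflexive (proj₁ (toProj-isProjection N)) (sym pM≈pN)))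

  toProj-surjective : ∀ {X} (p : X ⇒ X) → IsProjection p → Σ (†Mono X) λ M → toProj M ≈ p
  toProj-surjective p (pp≈p , p†≈p) =
    †mono (eq p id) (eq-†mono p id) ,
    †equaliser-of-projection (eq-equaliser p id) (eq-†mono p id) pp≈p p†≈p

proposition1 : ∀ {o ℓ e : Level} (H : PreHilbert o ℓ e) (X : PreHilbert.Obj H) →
    let open PreHilbert H in
    ((M : †Mono X) → IsProjection (toProj M))
    × ((M N : †Mono X) → M ≅ₛ N → toProj M ≈ toProj N)
    × ((M N : †Mono X) → (M ≤ₛ N) ⇔ (toProj M ⊑ toProj N))
    × ((M N : †Mono X) → toProj M ≈ toProj N → M ≅ₛ N)
    × ((p : X ⇒ X) → IsProjection p → Σ (†Mono X) λ M → toProj M ≈ p)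
proposition1 H X =
  toProj-isProjection , toProj-resp-≅ₛ , ≤ₛ⇔⊑ , toProj-injective , toProj-surjective
  where open ClosedSubobjectProperties H
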